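{- Let $N=p^{2k}$ with $p>3$ prime and $k\ge1$. Let $B\in SL(2,\mathbb{Z}_N)$, $x=(x_1,x_2)^T\in\mathbb{Z}_N^2$ and $x'=Bx=(x_1',x_2')^T$. Then $U_N(B)\zeta_x=e\!\left(\frac{r(x_1'x_2'-x_1x_2)}{N}\right)\zeta_{x'}$.
   Context: $e(x)=e^{2\pi ix}$. $U_N$ is the Weil representation of $SL(2,\mathbb{Z}_N)$ on $L^2(\mathbb{Z}_N)$, given on generators by $U_N(n_b)\psi(x)=e(rbx^2/N)\psi(x)$, $U_N(a_t)\psi(x)=\psi(tx)$, $U_N(\omega)\psi(x)=\frac{1}{\sqrt N}\sum_{y\in\mathbb{Z}_N}\psi(y)e(2rxy/N)$, where $n_b=\begin{pmatrix}1&b\\0&1\end{pmatrix}$, $a_t=\mathrm{diag}(t,t^{ -1})$, $\omega=\begin{pmatrix}0&1\\-1&0\end{pmatrix}$ and $r\in\mathbb{Z}_N$ satisfies $2r\equiv1\pmod N$ (for $N=p^{2k}$ the unimodular constants $\Lambda(t)$ and $S_r(-1,N)$ of the general construction equal $1$). For $x\in\mathbb{Z}_N$, $\delta_x$ is the indicator function of $\{x\}$, and for $x=(x_1,x_2)^T\in\mathbb{Z}_N^2$, $\zeta_x=\sum_{t\in\mathbb{Z}_{p^k}}e(x_1t/p^k)\,\delta_{x_2+p^kt}$. -}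

module Defs where

open import Level using (Level)
open import Data.Nat using (ℕ; zero; suc; NonZero)
import Data.Nat as ℕ
open import Data.Nat.DivMod using (_%_; m%n<n)
open import Data.Fin using (Fin; toℕ; fromℕ<)
open import Data.Fin.Properties using (_≟_)
open import Data.Bool using (if_then_else_)
open import Relation.Nullary.Decidable using (⌊_⌋)
open import Relation.Binary.PropositionalEquality using (_≡_)
open import Data.List using (List; []; _∷_)
open import Data.Product using (_×_; _,_)
open import Algebra.Bundles using (CommutativeRing)

module Weil {c ℓ : Level} (R : CommutativeRing c ℓ) (N : ℕ) {{nz : NonZero N}} where
  open CommutativeRing R hiding (zero)

  pow : Carrier → ℕ → Carrier
  pow x zero    = 1#
  pow x (suc n) = x * pow x n

  fromℕ : ℕ → Carrier
  fromℕ zero    = 0#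
  fromℕ (suc n) = 1# + fromℕ n

  sumFin : (n : ℕ) → (Fin n → Carrier) → Carrier
  sumFin zero    f = 0#
  sumFin (suc n) f = f Fin.zero + sumFin n (λ i → f (Fin.suc i))

  ZN : Set
  ZN = Fin N

  toZ : ℕ → ZN
  toZ m = fromℕ< (m%n<n m N)

  _⊕_ : ZN → ZN → ZN
  a ⊕ b = toZ (toℕ a ℕ.+ toℕ b)

  _⊗_ : ZN → ZN → ZN
  a ⊗ b = toZ (toℕ a ℕ.* toℕ b)

  ⊖_ : ZN → ZN
  ⊖ a = toZ (N ℕ.∸ toℕ a)

  _⊝_ : ZN → ZN → ZN
  a ⊝ b = a ⊕ (⊖ b)

  zeroZ oneZ twoZ : ZN
  zeroZ = toZ 0
  oneZ  = toZ 1
  twoZ  = toZ 2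

  -- e(a/N) for a ∈ Z_N, with ζ a fixed primitive N-th root of unity
  eN : Carrier → ZN → Carrier
  eN ζ a = pow ζ (toℕ a)

  Fun : Set c
  Fun = ZN → Carrier

  _≋_ : Fun → Fun → Set ℓ
  f ≋ g = ∀ z → f z ≈ g z

  δ : ZN → Fun
  δ y z = if ⌊ z ≟ y ⌋ then 1# else 0#

  -- 2×2 matrices over Z_N, stored as (a , b , c , d) = [[a,b],[c,d]]
  Mat : Set
  Mat = ZN × ZN × ZN × ZN

  _·M_ : Mat → Mat → Mat
  (a , b , c' , d) ·M (a' , b' , c'' , d') =
    ((a ⊗ a') ⊕ (b ⊗ c'')) , ((a ⊗ b') ⊕ (b ⊗ d')) ,
    ((c' ⊗ a') ⊕ (d ⊗ c'')) , ((c' ⊗ b') ⊕ (d ⊗ d'))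

  idM : Mat
  idM = oneZ , zeroZ , zeroZ , oneZ

  det : Mat → ZN
  det (a , b , c' , d) = (a ⊗ d) ⊝ (b ⊗ c')

  _▷_ : Mat → ZN × ZN → ZN × ZN
  (a , b , c' , d) ▷ (x₁ , x₂) = ((a ⊗ x₁) ⊕ (b ⊗ x₂)) , ((c' ⊗ x₁) ⊕ (d ⊗ x₂))

  data Gen : Set where
    nGen : ZN → Gen
    aGen : (t s : ZN) → t ⊗ s ≡ oneZ → Gen
    ωGen : Gen

  genMat : Gen → Mat
  genMat (nGen b)     = oneZ , b , zeroZ , oneZ
  genMat (aGen t s _) = t , zeroZ , zeroZ , s
  genMat ωGen         = zeroZ , oneZ , (⊖ oneZ) , zeroZ

  wordMat : List Gen → Mat
  wordMat []      = idM
  wordMat (g ∷ w) = genMat g ·M wordMat w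

  -- Weil representation on generators; ζ = e(1/N), r with 2r ≡ 1, invSqrtN = 1/√N
  Ugen : (ζ : Carrier) (r : ZN) (invSqrtN : Carrier) → Gen → Fun → Fun
  Ugen ζ r s (nGen b)     ψ x = eN ζ (r ⊗ (b ⊗ (x ⊗ x))) * ψ x
  Ugen ζ r s (aGen t _ _) ψ x = ψ (t ⊗ x)
  Ugen ζ r s ωGen         ψ x = s * sumFin N (λ y → ψ y * eN ζ ((twoZ ⊗ r) ⊗ (x ⊗ y)))

  Uword : (ζ : Carrier) (r : ZN) (invSqrtN : Carrier) → List Gen → Fun → Fun
  Uword ζ r s []      ψ = ψ
  Uword ζ r s (g ∷ w) ψ = Ugen ζ r s g (Uword ζ r s w ψ)

  -- ζ_x = Σ_{t ∈ Z_{p^k}} e(x₁ t / p^k) δ_{x₂ + p^k t}, where pk = p^k, N = pk²,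
  -- and e(x₁ t / p^k) = e(x₁ t p^k / N)
  zetaVec : (ζ : Carrier) (pk : ℕ) → ZN × ZN → Fun
  zetaVec ζ pk (x₁ , x₂) z =
    sumFin pk (λ t → eN ζ (x₁ ⊗ (toZ (toℕ t) ⊗ toZ pk)) * δ (x₂ ⊕ (toZ pk ⊗ toZ (toℕ t))) z)

-- Lift ℤ_N to ℤ and write e(a/N) as the character e a = ζ^(a mod N). The vector ζ_x is
-- supported on the coset x₂ + p^k ℤ_N, where ζ_x(z) = e(x₁ (z − x₂)); twisted by e(r x₁ x₂)
-- it becomes e(θ) with θ = r x₁ x₂ + x₁ (z − x₂). Each generator carries the twisted vector
-- of x to the twisted vector of its image: for n_b and a_t this is a congruence of exponents
-- modulo N = p^(2k) (using 2r ≡ 1, ts ≡ 1 and (z − x₂)² ≡ 0 on the coset), and for ω the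
-- Fourier sum over the coset is e(z x₂) times a geometric sum in w = e((x₁ + z) p^k), which
-- is p^k when p^k ∣ x₁ + z and 0 otherwise: w^(p^k) = 1, R has no zero divisors and ζ is
-- primitive.

module Submission where

open import Defs
open import Level using (Level)
open import Data.Nat using (ℕ; NonZero)
import Data.Nat as ℕ
open import Data.Nat.Divisibility using (_∣_)
open import Data.Nat.Primality using (Prime)
open import Data.Sum using (_⊎_)
open import Data.Product using (_×_; _,_)
open import Data.List using (List)
open import Relation.Binary.PropositionalEquality using (_≡_)
open import Algebra.Bundles using (CommutativeRing)

open import Data.Fin as Fin using (Fin; toℕ; fromℕ<; punchIn)
open import Data.Fin.Properties using (toℕ-fromℕ<; toℕ<n; toℕ-injective; punchInᵢ≢i; _≟_)
open import Data.Integer as ℤ using (ℤ; +_; ∣_∣)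
open import Data.Integer.DivMod using (_%ℕ_; _/ℕ_; n%ℕd<d; a≡a%ℕn+[a/ℕn]*n)
open import Data.Integer.Divisibility.Signed as ℤ∣
  using (divides; ∣m⇒∣-m; ∣m∣n⇒∣m+n; ∣m∣n⇒∣m-n; ∣n⇒∣m*n; ∣m⇒∣m*n; ∣⇒∣ᵤ)
  renaming (_∣_ to _∣ℤ_; _∣?_ to _∣ℤ?_)
import Data.Integer.Properties as ℤₚ
open import Data.Integer.Tactic.RingSolver using (solve-∀)
open import Data.List using ([]; _∷_)
open import Data.Nat.Divisibility using (divides; ∣⇒≤)
open import Data.Nat.DivMod using (m%n<n; m≡m%n+[m/n]*n)
import Data.Nat.Properties as ℕₚ
open import Data.Product using (proj₁; proj₂)
open import Data.Sum using (inj₁; inj₂)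
open import Data.Vec.Functional using (Vector; removeAt; replicate)
open import Function using (_∘_)
open import Relation.Binary.Bundles using (Setoid)
open import Relation.Binary.PropositionalEquality as ≡ using (_≢_)
import Relation.Binary.Reasoning.Setoid
open import Relation.Binary.Structures using (IsEquivalence)
open import Relation.Nullary using (¬_; yes; no; contradiction)

-- Congruence modulo n on ℤ

-- A record rather than an abbreviation of  + n ∣ a - b,  so that a and b stay inferable.
infix 4 _≡_mod_
record _≡_mod_ (a b : ℤ) (n : ℕ) : Set where
  constructor by-∣
  field ∣-difference : + n ∣ℤ a ℤ.- b

module _ {n : ℕ} where

  mod-reflexive : ∀ {a b} → a ≡ b → a ≡ b mod n
  mod-reflexive {a} ≡.refl = by-∣ (divides (+ 0) (ℤₚ.+-inverseʳ a))

  mod-refl : ∀ {a} → a ≡ a mod n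
  mod-refl = mod-reflexive ≡.refl

  mod-sym : ∀ {a b} → a ≡ b mod n → b ≡ a mod n
  mod-sym {a} {b} (by-∣ n∣a-b) = by-∣ (≡.subst (+ n ∣ℤ_) (flip a b) (∣m⇒∣-m n∣a-b))
    where
    flip : ∀ a b → ℤ.- (a ℤ.- b) ≡ b ℤ.- a
    flip = solve-∀

  mod-trans : ∀ {a b c} → a ≡ b mod n → b ≡ c mod n → a ≡ c mod n
  mod-trans {a} {b} {c} (by-∣ n∣a-b) (by-∣ n∣b-c) =
    by-∣ (≡.subst (+ n ∣ℤ_) (telescope a b c) (∣m∣n⇒∣m+n n∣a-b n∣b-c))
    where
    telescope : ∀ a b c → (a ℤ.- b) ℤ.+ (b ℤ.- c) ≡ a ℤ.- c
    telescope = solve-∀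

  +-cong-mod : ∀ {a a′ b b′} → a ≡ a′ mod n → b ≡ b′ mod n → a ℤ.+ b ≡ a′ ℤ.+ b′ mod n
  +-cong-mod {a} {a′} {b} {b′} (by-∣ n∣a-a′) (by-∣ n∣b-b′) =
    by-∣ (≡.subst (+ n ∣ℤ_) (regroup a a′ b b′) (∣m∣n⇒∣m+n n∣a-a′ n∣b-b′))
    where
    regroup : ∀ a a′ b b′ → (a ℤ.- a′) ℤ.+ (b ℤ.- b′) ≡ (a ℤ.+ b) ℤ.- (a′ ℤ.+ b′)
    regroup = solve-∀

  *-cong-mod : ∀ {a a′ b b′} → a ≡ a′ mod n → b ≡ b′ mod n → a ℤ.* b ≡ a′ ℤ.* b′ mod n
  *-cong-mod {a} {a′} {b} {b′} (by-∣ n∣a-a′) (by-∣ n∣b-b′) =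
    by-∣ (≡.subst (+ n ∣ℤ_) (regroup a a′ b b′) (∣m∣n⇒∣m+n (∣n⇒∣m*n a n∣b-b′) (∣m⇒∣m*n b′ n∣a-a′)))
    where
    regroup : ∀ a a′ b b′ → a ℤ.* (b ℤ.- b′) ℤ.+ (a ℤ.- a′) ℤ.* b′ ≡ a ℤ.* b ℤ.- a′ ℤ.* b′
    regroup = solve-∀

  +-congˡ-mod : ∀ a {b b′} → b ≡ b′ mod n → a ℤ.+ b ≡ a ℤ.+ b′ mod n
  +-congˡ-mod a = +-cong-mod (mod-refl {a})

  +-congʳ-mod : ∀ b {a a′} → a ≡ a′ mod n → a ℤ.+ b ≡ a′ ℤ.+ b mod n
  +-congʳ-mod b a≡a′ = +-cong-mod a≡a′ (mod-refl {b})

  *-congˡ-mod : ∀ a {b b′} → b ≡ b′ mod n → a ℤ.* b ≡ a ℤ.* b′ mod n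
  *-congˡ-mod a = *-cong-mod (mod-refl {a})

  *-congʳ-mod : ∀ b {a a′} → a ≡ a′ mod n → a ℤ.* b ≡ a′ ℤ.* b mod n
  *-congʳ-mod b a≡a′ = *-cong-mod a≡a′ (mod-refl {b})

  neg-cong-mod : ∀ {a a′} → a ≡ a′ mod n → ℤ.- a ≡ ℤ.- a′ mod n
  neg-cong-mod {a} {a′} (by-∣ n∣a-a′) = by-∣ (≡.subst (+ n ∣ℤ_) (regroup a a′) (∣m⇒∣-m n∣a-a′))
    where
    regroup : ∀ a a′ → ℤ.- (a ℤ.- a′) ≡ ℤ.- a ℤ.- ℤ.- a′
    regroup = solve-∀

  multiple≡0-mod : ∀ k → k ℤ.* + n ≡ + 0 mod n
  multiple≡0-mod k = by-∣ (divides k (ℤₚ.+-identityʳ (k ℤ.* + n)))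

  n≡0-mod : + n ≡ + 0 mod n
  n≡0-mod = ≡.subst (_≡ + 0 mod n) (ℤₚ.*-identityˡ (+ n)) (multiple≡0-mod (+ 1))

  mod⇒difference≡0 : ∀ {a b} → a ≡ b mod n → a ℤ.- b ≡ + 0 mod n
  mod⇒difference≡0 {a} {b} (by-∣ n∣a-b) = by-∣ (≡.subst (+ n ∣ℤ_) (≡.sym (ℤₚ.+-identityʳ (a ℤ.- b))) n∣a-b)

  +-*-zeroʳ-mod : ∀ a c {k} → k ≡ + 0 mod n → a ℤ.+ c ℤ.* k ≡ a mod n
  +-*-zeroʳ-mod a c k≡0 =
    mod-trans (+-congˡ-mod a (*-congˡ-mod c k≡0)) (mod-reflexive (drop a c))
    where
    drop : ∀ a c → a ℤ.+ c ℤ.* + 0 ≡ a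
    drop = solve-∀

  +-cancelˡ-mod : ∀ a {b c} → a ℤ.+ b ≡ a ℤ.+ c mod n → b ≡ c mod n
  +-cancelˡ-mod a {b} {c} a+b≡a+c = ≡.subst₂ (λ i j → i ≡ j mod n) (cancel a b) (cancel a c) (+-congˡ-mod (ℤ.- a) a+b≡a+c)
    where
    cancel : ∀ a b → ℤ.- a ℤ.+ (a ℤ.+ b) ≡ b
    cancel = solve-∀

  mod-isEquivalence : IsEquivalence (λ a b → a ≡ b mod n)
  mod-isEquivalence = record { refl = mod-refl ; sym = mod-sym ; trans = mod-trans }

ℤ-mod-setoid : ℕ → Setoid _ _
ℤ-mod-setoid n = record { isEquivalence = mod-isEquivalence {n} }

module ≡-mod-Reasoning (n : ℕ) = Relation.Binary.Reasoning.Setoid (ℤ-mod-setoid n)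

module _ {n : ℕ} .{{_ : NonZero n}} where

  %ℕ-residue : ∀ a → a ≡ + (a %ℕ n) mod n
  %ℕ-residue a = by-∣ (divides (a /ℕ n)
    (≡.trans (≡.cong (ℤ._- + (a %ℕ n)) (a≡a%ℕn+[a/ℕn]*n a n)) (cancel (+ (a %ℕ n)) (a /ℕ n) (+ n))))
    where
    cancel : ∀ r q m → (r ℤ.+ q ℤ.* m) ℤ.- r ≡ q ℤ.* m
    cancel = solve-∀

  residues-unique : ∀ {m m′} → m ℕ.< n → m′ ℕ.< n → + m ≡ + m′ mod n → m ≡ m′
  residues-unique {m} {m′} m<n m′<n (by-∣ n∣m-m′) =
    ℤₚ.+-injective (ℤₚ.i-j≡0⇒i≡j (+ m) (+ m′) (ℤₚ.∣i∣≡0⇒i≡0 (small-multiple (∣⇒∣ᵤ n∣m-m′) distance<n)))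
    where
    distance<n : ∣ + m ℤ.- + m′ ∣ ℕ.< n
    distance<n = ℕₚ.≤-<-trans (≡.subst (ℕ._≤ m ℕ.⊔ m′) (≡.cong ∣_∣ (≡.sym (ℤₚ.m-n≡m⊖n m m′))) (ℤₚ.∣m⊝n∣≤m⊔n m m′))
                              (ℕₚ.⊔-lub m<n m′<n)
    small-multiple : ∀ {d} → n ∣ d → d ℕ.< n → d ≡ 0
    small-multiple {ℕ.zero}  _   _   = ≡.refl
    small-multiple {ℕ.suc _} n∣d d<n = contradiction (∣⇒≤ n∣d) (ℕₚ.<⇒≱ d<n)

  %ℕ-cong : ∀ {a b} → a ≡ b mod n → a %ℕ n ≡ b %ℕ n
  %ℕ-cong {a} {b} a≡b = residues-unique (n%ℕd<d a n) (n%ℕd<d b n)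
    (mod-trans (mod-sym (%ℕ-residue a)) (mod-trans a≡b (%ℕ-residue b)))

module _ {N pk : ℕ} .{{_ : NonZero pk}} (N≡pk*pk : N ≡ pk ℕ.* pk) where

  private
    +N≡pk*pk : + N ≡ + pk ℤ.* + pk
    +N≡pk*pk = ≡.trans (≡.cong +_ N≡pk*pk) (ℤₚ.pos-* pk pk)

    pk*-difference : ∀ a b → + pk ℤ.* a ℤ.- + pk ℤ.* b ≡ + pk ℤ.* (a ℤ.- b)
    pk*-difference a b = solve (+ pk) a b
      where
      solve : ∀ p a b → p ℤ.* a ℤ.- p ℤ.* b ≡ p ℤ.* (a ℤ.- b)
      solve = solve-∀

    pk*multiple : ∀ q → + pk ℤ.* (q ℤ.* + pk) ≡ q ℤ.* + N
    pk*multiple q = ≡.trans (solve (+ pk) q) (≡.cong (q ℤ.*_) (≡.sym +N≡pk*pk))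
      where
      solve : ∀ p q → p ℤ.* (q ℤ.* p) ≡ q ℤ.* (p ℤ.* p)
      solve = solve-∀

  multiple-of-pk²≡0 : ∀ q → q ℤ.* (+ pk ℤ.* + pk) ≡ + 0 mod N
  multiple-of-pk²≡0 q = ≡.subst (λ m → q ℤ.* m ≡ + 0 mod N) +N≡pk*pk (multiple≡0-mod q)

  ∣-resp-mod : ∀ {a b} → a ≡ b mod N → + pk ∣ℤ a → + pk ∣ℤ b
  ∣-resp-mod {a} {b} (by-∣ N∣a-b) pk∣a =
    ≡.subst (+ pk ∣ℤ_) (cancel a b) (∣m∣n⇒∣m-n pk∣a (ℤ∣.∣-trans (divides (+ pk) +N≡pk*pk) N∣a-b))
    where
    cancel : ∀ a b → a ℤ.- (a ℤ.- b) ≡ b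
    cancel = solve-∀

  ∣⇒*pk≡0 : ∀ {a} → + pk ∣ℤ a → a ℤ.* + pk ≡ + 0 mod N
  ∣⇒*pk≡0 (divides u ≡.refl) = mod-trans (mod-reflexive (ℤₚ.*-assoc u (+ pk) (+ pk))) (multiple-of-pk²≡0 u)

  ∣⇒square≡0 : ∀ {d} → + pk ∣ℤ d → d ℤ.* d ≡ + 0 mod N
  ∣⇒square≡0 (divides u ≡.refl) = mod-trans (mod-reflexive (regroup u (+ pk))) (multiple-of-pk²≡0 (u ℤ.* u))
    where
    regroup : ∀ u p → u ℤ.* p ℤ.* (u ℤ.* p) ≡ u ℤ.* u ℤ.* (p ℤ.* p)
    regroup = solve-∀

  *pk≡0⇒∣ : ∀ {a} → a ℤ.* + pk ≡ + 0 mod N → + pk ∣ℤ a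
  *pk≡0⇒∣ {a} (by-∣ (divides q a*pk-0≡q*N)) = divides q (ℤₚ.*-cancelʳ-≡ a (q ℤ.* + pk) (+ pk) (begin
    a ℤ.* + pk                  ≡⟨ ℤₚ.+-identityʳ (a ℤ.* + pk) ⟨
    a ℤ.* + pk ℤ.- + 0          ≡⟨ a*pk-0≡q*N ⟩
    q ℤ.* + N                   ≡⟨ ≡.cong (q ℤ.*_) +N≡pk*pk ⟩
    q ℤ.* (+ pk ℤ.* + pk)       ≡⟨ ℤₚ.*-assoc q (+ pk) (+ pk) ⟨
    q ℤ.* + pk ℤ.* + pk         ∎))
    where open ≡.≡-Reasoning

  pk*-cong-mod : ∀ {a b} → a ≡ b mod pk → + pk ℤ.* a ≡ + pk ℤ.* b mod N
  pk*-cong-mod {a} {b} (by-∣ (divides q a-b≡q*pk)) = by-∣ (divides q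
    (≡.trans (pk*-difference a b) (≡.trans (≡.cong (+ pk ℤ.*_) a-b≡q*pk) (pk*multiple q))))

  pk*-cancel-mod : ∀ {a b} → + pk ℤ.* a ≡ + pk ℤ.* b mod N → a ≡ b mod pk
  pk*-cancel-mod {a} {b} (by-∣ (divides q pka-pkb≡q*N)) = by-∣ (divides q (ℤₚ.*-cancelˡ-≡ (+ pk) (a ℤ.- b) (q ℤ.* + pk)
    (≡.trans (≡.sym (pk*-difference a b)) (≡.trans pka-pkb≡q*N (≡.sym (pk*multiple q))))))

-- Finite sums and geometric sums in a commutative ring

module _ {c ℓ : Level} (R : CommutativeRing c ℓ) where
  open CommutativeRing R hiding (zero)
  open import Algebra.Properties.Semiring.Sum semiring
  open import Algebra.Properties.Semiring.Exp semiring using (_^_; ^-homo-*; ^-congˡ; ^-assocʳ)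
  open import Algebra.Properties.Group +-group using (∙-cancelʳ; x∙y⁻¹≈ε⇒x≈y)
  open import Algebra.Properties.Ring ring using (-‿distribˡ-*)
  open import Algebra.Properties.CommutativeSemigroup *-commutativeSemigroup using (x∙yz≈y∙xz)
  import Relation.Binary.Reasoning.Setoid setoid as ≈-Reasoning

  sum-select : ∀ {n} (f : Vector Carrier n) i → (∀ j → j ≢ i → f j ≈ 0#) → sum f ≈ f i
  sum-select {ℕ.suc n} f i f≈0 = begin
    sum f                        ≈⟨ sum-remove f ⟩
    f i + sum (removeAt f i)     ≈⟨ +-congˡ (sum-cong-≋ (λ j → f≈0 (punchIn i j) (punchInᵢ≢i i j))) ⟩
    f i + sum (replicate n 0#)   ≈⟨ +-congˡ (sum-replicate-zero n) ⟩
    f i + 0#                     ≈⟨ +-identityʳ (f i) ⟩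
    f i                          ∎
    where open ≈-Reasoning

  sum-zero : ∀ {n} (f : Vector Carrier n) → (∀ j → f j ≈ 0#) → sum f ≈ 0#
  sum-zero {n} f f≈0 = trans (sum-cong-≋ f≈0) (sum-replicate-zero n)

  geometric-sum : Carrier → ℕ → Carrier
  geometric-sum w n = sum {n} (λ i → w ^ toℕ i)

  geometric-sum-suc : ∀ w n → geometric-sum w (ℕ.suc n) ≈ 1# + w * geometric-sum w n
  geometric-sum-suc w n = +-congˡ (sym (*-distribˡ-sum {n} w (λ i → w ^ toℕ i)))

  geometric-sum-shift : ∀ w n → w * geometric-sum w n + 1# ≈ geometric-sum w n + w ^ n
  geometric-sum-shift w ℕ.zero = +-congʳ (zeroʳ w)
  geometric-sum-shift w (ℕ.suc n) = begin
    w * G (ℕ.suc n) + 1#             ≈⟨ +-congʳ (*-congˡ (geometric-sum-suc w n)) ⟩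
    w * (1# + w * G n) + 1#          ≈⟨ +-congʳ (distribˡ w 1# (w * G n)) ⟩
    (w * 1# + w * (w * G n)) + 1#    ≈⟨ +-congʳ (+-comm _ _) ⟩
    (w * (w * G n) + w * 1#) + 1#    ≈⟨ +-congʳ (sym (distribˡ w (w * G n) 1#)) ⟩
    w * (w * G n + 1#) + 1#          ≈⟨ +-congʳ (*-congˡ (geometric-sum-shift w n)) ⟩
    w * (G n + w ^ n) + 1#           ≈⟨ +-congʳ (distribˡ w (G n) (w ^ n)) ⟩
    (w * G n + w * w ^ n) + 1#       ≈⟨ +-comm _ 1# ⟩
    1# + (w * G n + w * w ^ n)       ≈⟨ sym (+-assoc 1# _ _) ⟩
    (1# + w * G n) + w ^ ℕ.suc n     ≈⟨ +-congʳ (sym (geometric-sum-suc w n)) ⟩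
    G (ℕ.suc n) + w ^ ℕ.suc n        ∎
    where
    open ≈-Reasoning
    G = geometric-sum w

  root-of-unity⇒geometric-sum≈0 : ∀ {w n} → w ^ n ≈ 1# → (w - 1#) * geometric-sum w n ≈ 0#
  root-of-unity⇒geometric-sum≈0 {w} {n} wⁿ≈1 = begin
    (w - 1#) * G                ≈⟨ distribʳ G w (- 1#) ⟩
    w * G + - 1# * G            ≈⟨ +-cong w*G≈G (sym (-‿distribˡ-* 1# G)) ⟩
    G + - (1# * G)              ≈⟨ +-congˡ (-‿cong (*-identityˡ G)) ⟩
    G - G                       ≈⟨ -‿inverseʳ G ⟩
    0#                          ∎
    where
    open ≈-Reasoning
    G = geometric-sum w n
    w*G≈G : w * G ≈ G
    w*G≈G = ∙-cancelʳ 1# (w * G) G (trans (geometric-sum-shift w n) (+-congˡ wⁿ≈1))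

  geometric-sum-dichotomy : (∀ a b → a * b ≈ 0# → a ≈ 0# ⊎ b ≈ 0#) →
    ∀ {w n} → w ^ n ≈ 1# → w ≈ 1# ⊎ geometric-sum w n ≈ 0#
  geometric-sum-dichotomy no-zero-divisors {w} {n} wⁿ≈1 with no-zero-divisors _ _ (root-of-unity⇒geometric-sum≈0 {w} {n} wⁿ≈1)
  ... | inj₁ w-1≈0 = inj₁ (x∙y⁻¹≈ε⇒x≈y w 1# w-1≈0)
  ... | inj₂ G≈0   = inj₂ G≈0

  1#^n≈1# : ∀ n → 1# ^ n ≈ 1#
  1#^n≈1# ℕ.zero    = refl
  1#^n≈1# (ℕ.suc n) = trans (*-identityˡ (1# ^ n)) (1#^n≈1# n)

  module _ (N : ℕ) {{_ : NonZero N}} where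
    open Weil R N

    pow≡^ : ∀ x n → pow x n ≡ x ^ n
    pow≡^ x ℕ.zero    = ≡.refl
    pow≡^ x (ℕ.suc n) = ≡.cong (x *_) (pow≡^ x n)

    sumFin≡sum : ∀ n f → sumFin n f ≡ sum f
    sumFin≡sum ℕ.zero    f = ≡.refl
    sumFin≡sum (ℕ.suc n) f = ≡.cong (_+_ (f Fin.zero)) (sumFin≡sum n (f ∘ Fin.suc))

    sumFin-cong : ∀ {n f g} → (∀ i → f i ≈ g i) → sumFin n f ≈ sumFin n g
    sumFin-cong {n} {f} {g} f≈g = trans (reflexive (sumFin≡sum n f)) (trans (sum-cong-≋ f≈g) (reflexive (≡.sym (sumFin≡sum n g))))

    fromℕ≡sum-of-1# : ∀ n → fromℕ n ≡ sum {n} (λ _ → 1#)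
    fromℕ≡sum-of-1# ℕ.zero    = ≡.refl
    fromℕ≡sum-of-1# (ℕ.suc n) = ≡.cong (_+_ 1#) (fromℕ≡sum-of-1# n)

    -- Lifting ℤ_N to ℤ

    -- Opaque so that unification never unfolds ι into the mod-N arithmetic of toZ.
    opaque
      ι : ZN → ℤ
      ι a = + toℕ a

      ι≡+toℕ : ∀ a → ι a ≡ + toℕ a
      ι≡+toℕ a = ≡.refl

    ι-toZ : ∀ m → ι (toZ m) ≡ + m mod N
    ι-toZ m = ≡.subst (_≡ + m mod N) (≡.sym (≡.trans (ι≡+toℕ (toZ m)) (≡.cong +_ (toℕ-fromℕ< (m%n<n m N)))))
                      (mod-sym (%ℕ-residue (+ m)))

    ι-⊕ : ∀ a b → ι (a ⊕ b) ≡ ι a ℤ.+ ι b mod N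
    ι-⊕ a b = mod-trans (ι-toZ _) (mod-reflexive (≡.trans (ℤₚ.pos-+ (toℕ a) (toℕ b)) (≡.sym (≡.cong₂ ℤ._+_ (ι≡+toℕ a) (ι≡+toℕ b)))))

    ι-⊗ : ∀ a b → ι (a ⊗ b) ≡ ι a ℤ.* ι b mod N
    ι-⊗ a b = mod-trans (ι-toZ _) (mod-reflexive (≡.trans (ℤₚ.pos-* (toℕ a) (toℕ b)) (≡.sym (≡.cong₂ ℤ._*_ (ι≡+toℕ a) (ι≡+toℕ b)))))

    ι-⊖ : ∀ a → ι (⊖ a) ≡ ℤ.- ι a mod N
    ι-⊖ a = mod-trans (ι-toZ _) (mod-trans (mod-reflexive N∸a≡N-a)
              (mod-trans (+-congʳ-mod (ℤ.- ι a) n≡0-mod) (mod-reflexive (ℤₚ.+-identityˡ (ℤ.- ι a)))))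
      where
      N∸a≡N-a : + (N ℕ.∸ toℕ a) ≡ + N ℤ.- ι a
      N∸a≡N-a = ≡.trans (≡.sym (ℤₚ.⊖-≥ (ℕₚ.<⇒≤ (toℕ<n a))))
                (≡.trans (≡.sym (ℤₚ.m-n≡m⊖n N (toℕ a))) (≡.cong (λ i → + N ℤ.- i) (≡.sym (ι≡+toℕ a))))

    ι-injective : ∀ {a b} → ι a ≡ ι b mod N → a ≡ b
    ι-injective {a} {b} a≡b = toℕ-injective (residues-unique (toℕ<n a) (toℕ<n b)
      (≡.subst₂ (λ i j → i ≡ j mod N) (ι≡+toℕ a) (ι≡+toℕ b) a≡b))

    ι-lin : ∀ a b x y → ι ((a ⊗ x) ⊕ (b ⊗ y)) ≡ ι a ℤ.* ι x ℤ.+ ι b ℤ.* ι y mod N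
    ι-lin a b x y = mod-trans (ι-⊕ _ _) (+-cong-mod (ι-⊗ a x) (ι-⊗ b y))

    ι-1⊗ : ∀ a → ι (oneZ ⊗ a) ≡ ι a mod N
    ι-1⊗ a = mod-trans (ι-⊗ oneZ a) (mod-trans (*-congʳ-mod (ι a) (ι-toZ 1)) (mod-reflexive (ℤₚ.*-identityˡ (ι a))))

    ι-0⊗ : ∀ a → ι (zeroZ ⊗ a) ≡ + 0 mod N
    ι-0⊗ a = mod-trans (ι-⊗ zeroZ a) (*-congʳ-mod (ι a) (ι-toZ 0))

    ι-0⊗⊕ : ∀ a b → ι ((zeroZ ⊗ a) ⊕ b) ≡ ι b mod N
    ι-0⊗⊕ a b = mod-trans (ι-⊕ _ b) (mod-trans (+-congʳ-mod (ι b) (ι-0⊗ a)) (mod-reflexive (ℤₚ.+-identityˡ (ι b))))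

    ι-⊕0⊗ : ∀ a b → ι (a ⊕ (zeroZ ⊗ b)) ≡ ι a mod N
    ι-⊕0⊗ a b = mod-trans (ι-⊕ a _) (mod-trans (+-congˡ-mod (ι a) (ι-0⊗ b)) (mod-reflexive (ℤₚ.+-identityʳ (ι a))))

    ▷-·M : ∀ M M′ v → (M ·M M′) ▷ v ≡ M ▷ (M′ ▷ v)
    ▷-·M (a , b , c , d) (a′ , b′ , c′ , d′) (x , y) = ≡.cong₂ _,_ (row a b) (row c d)
      where
      open ≡-mod-Reasoning N
      regroup : ∀ a b a′ b′ c′ d′ x y →
        (a ℤ.* a′ ℤ.+ b ℤ.* c′) ℤ.* x ℤ.+ (a ℤ.* b′ ℤ.+ b ℤ.* d′) ℤ.* y
          ≡ a ℤ.* (a′ ℤ.* x ℤ.+ b′ ℤ.* y) ℤ.+ b ℤ.* (c′ ℤ.* x ℤ.+ d′ ℤ.* y)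
      regroup = solve-∀
      row : ∀ a b → (((a ⊗ a′) ⊕ (b ⊗ c′)) ⊗ x) ⊕ (((a ⊗ b′) ⊕ (b ⊗ d′)) ⊗ y)
                    ≡ (a ⊗ ((a′ ⊗ x) ⊕ (b′ ⊗ y))) ⊕ (b ⊗ ((c′ ⊗ x) ⊕ (d′ ⊗ y)))
      row a b = ι-injective (begin
        ι ((((a ⊗ a′) ⊕ (b ⊗ c′)) ⊗ x) ⊕ (((a ⊗ b′) ⊕ (b ⊗ d′)) ⊗ y))
          ≈⟨ ι-lin _ _ x y ⟩
        ι ((a ⊗ a′) ⊕ (b ⊗ c′)) ℤ.* ι x ℤ.+ ι ((a ⊗ b′) ⊕ (b ⊗ d′)) ℤ.* ι y
          ≈⟨ +-cong-mod (*-congʳ-mod (ι x) (ι-lin a b a′ c′)) (*-congʳ-mod (ι y) (ι-lin a b b′ d′)) ⟩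
        (ι a ℤ.* ι a′ ℤ.+ ι b ℤ.* ι c′) ℤ.* ι x ℤ.+ (ι a ℤ.* ι b′ ℤ.+ ι b ℤ.* ι d′) ℤ.* ι y
          ≡⟨ regroup (ι a) (ι b) (ι a′) (ι b′) (ι c′) (ι d′) (ι x) (ι y) ⟩
        ι a ℤ.* (ι a′ ℤ.* ι x ℤ.+ ι b′ ℤ.* ι y) ℤ.+ ι b ℤ.* (ι c′ ℤ.* ι x ℤ.+ ι d′ ℤ.* ι y)
          ≈⟨ +-cong-mod (*-congˡ-mod (ι a) (ι-lin a′ b′ x y)) (*-congˡ-mod (ι b) (ι-lin c′ d′ x y)) ⟨
        ι a ℤ.* ι ((a′ ⊗ x) ⊕ (b′ ⊗ y)) ℤ.+ ι b ℤ.* ι ((c′ ⊗ x) ⊕ (d′ ⊗ y))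
          ≈⟨ ι-lin a b _ _ ⟨
        ι ((a ⊗ ((a′ ⊗ x) ⊕ (b′ ⊗ y))) ⊕ (b ⊗ ((c′ ⊗ x) ⊕ (d′ ⊗ y)))) ∎)

    idM-▷ : ∀ v → idM ▷ v ≡ v
    idM-▷ (x , y) = ≡.cong₂ _,_ (ι-injective (mod-trans (ι-⊕0⊗ _ y) (ι-1⊗ x)))
                                (ι-injective (mod-trans (ι-0⊗⊕ x _) (ι-1⊗ y)))

    δ-self : ∀ y → δ y y ≈ 1#
    δ-self y with y ≟ y
    ... | yes _   = refl
    ... | no  y≢y = contradiction ≡.refl y≢y

    δ-other : ∀ {y z} → z ≢ y → δ y z ≈ 0#
    δ-other {y} {z} z≢y with z ≟ y
    ... | yes z≡y = contradiction z≡y z≢y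
    ... | no  _   = refl

    sum-against-δ : ∀ {m} (c : Fin m → Carrier) (p : Fin m → ZN) (g : ZN → Carrier) →
      sum {N} (λ y → sum {m} (λ t → c t * δ (p t) y) * g y) ≈ sum {m} (λ t → c t * g (p t))
    sum-against-δ {m} c p g = begin
      sum {N} (λ y → sum {m} (λ t → c t * δ (p t) y) * g y)   ≈⟨ sum-cong-≋ (λ y → *-distribʳ-sum (g y) (λ t → c t * δ (p t) y)) ⟩
      sum {N} (λ y → sum {m} (λ t → c t * δ (p t) y * g y))   ≈⟨ ∑-comm (λ y t → c t * δ (p t) y * g y) ⟩
      sum {m} (λ t → sum {N} (λ y → c t * δ (p t) y * g y))   ≈⟨ sum-cong-≋ (λ t → sum-select _ (p t) (off-diagonal t)) ⟩
      sum {m} (λ t → c t * δ (p t) (p t) * g (p t))           ≈⟨ sum-cong-≋ (λ t → *-congʳ (trans (*-congˡ (δ-self (p t))) (*-identityʳ (c t)))) ⟩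
      sum {m} (λ t → c t * g (p t))                           ∎
      where
      open ≈-Reasoning
      off-diagonal : ∀ t y → y ≢ p t → c t * δ (p t) y * g y ≈ 0#
      off-diagonal t y y≢pt = trans (*-congʳ (trans (*-congˡ (δ-other y≢pt)) (zeroʳ (c t)))) (zeroˡ (g y))

    -- The additive character e(a/N)

    module _ (ζ : Carrier) (powζN≈1 : pow ζ N ≈ 1#) where

      ζ^N≈1 : ζ ^ N ≈ 1#
      ζ^N≈1 = trans (reflexive (≡.sym (pow≡^ ζ N))) powζN≈1

      opaque
        e : ℤ → Carrier
        e a = ζ ^ (a %ℕ N)

        e-cong : ∀ {a b} → a ≡ b mod N → e a ≈ e b
        e-cong a≡b = reflexive (≡.cong (ζ ^_) (%ℕ-cong a≡b))

        ζ^≈e : ∀ m → ζ ^ m ≈ e (+ m)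
        ζ^≈e m = begin
          ζ ^ m                                      ≡⟨ ≡.cong (ζ ^_) (m≡m%n+[m/n]*n m N) ⟩
          ζ ^ (m ℕ.% N ℕ.+ m ℕ./ N ℕ.* N)            ≈⟨ ^-homo-* ζ (m ℕ.% N) (m ℕ./ N ℕ.* N) ⟩
          ζ ^ (m ℕ.% N) * ζ ^ (m ℕ./ N ℕ.* N)        ≡⟨ ≡.cong (λ k → ζ ^ (m ℕ.% N) * ζ ^ k) (ℕₚ.*-comm (m ℕ./ N) N) ⟩
          ζ ^ (m ℕ.% N) * ζ ^ (N ℕ.* (m ℕ./ N))      ≈⟨ *-congˡ (^-assocʳ ζ N (m ℕ./ N)) ⟨
          ζ ^ (m ℕ.% N) * (ζ ^ N) ^ (m ℕ./ N)        ≈⟨ *-congˡ (trans (^-congˡ (m ℕ./ N) ζ^N≈1) (1#^n≈1# (m ℕ./ N))) ⟩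
          ζ ^ (m ℕ.% N) * 1#                         ≈⟨ *-identityʳ _ ⟩
          e (+ m)                                    ∎
          where open ≈-Reasoning

      e-+ : ∀ a b → e (a ℤ.+ b) ≈ e a * e b
      e-+ a b = begin
        e (a ℤ.+ b)                              ≈⟨ e-cong (+-cong-mod (%ℕ-residue a) (%ℕ-residue b)) ⟩
        e (+ (a %ℕ N) ℤ.+ + (b %ℕ N))            ≡⟨ ≡.cong e (ℤₚ.pos-+ (a %ℕ N) (b %ℕ N)) ⟨
        e (+ (a %ℕ N ℕ.+ b %ℕ N))                ≈⟨ ζ^≈e _ ⟨
        ζ ^ (a %ℕ N ℕ.+ b %ℕ N)                  ≈⟨ ^-homo-* ζ (a %ℕ N) (b %ℕ N) ⟩
        ζ ^ (a %ℕ N) * ζ ^ (b %ℕ N)              ≈⟨ *-cong (ζ^≈e _) (ζ^≈e _) ⟩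
        e (+ (a %ℕ N)) * e (+ (b %ℕ N))          ≈⟨ *-cong (e-cong (%ℕ-residue a)) (e-cong (%ℕ-residue b)) ⟨
        e a * e b                                ∎
        where open ≈-Reasoning

      e-0 : e (+ 0) ≈ 1#
      e-0 = sym (ζ^≈e 0)

      e-^ : ∀ a n → e (a ℤ.* + n) ≈ e a ^ n
      e-^ a ℕ.zero    = trans (e-cong (mod-reflexive (ℤₚ.*-zeroʳ a))) e-0
      e-^ a (ℕ.suc n) = trans (e-cong (mod-reflexive (unfold a (+ n)))) (trans (e-+ a (a ℤ.* + n)) (*-congˡ (e-^ a n)))
        where
        unfold : ∀ a n → a ℤ.* (+ 1 ℤ.+ n) ≡ a ℤ.+ a ℤ.* n
        unfold = solve-∀

      e-neg : ∀ a → e (ℤ.- a) * e a ≈ 1#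
      e-neg a = trans (sym (e-+ (ℤ.- a) a)) (trans (e-cong (mod-reflexive (ℤₚ.+-inverseˡ a))) e-0)

      eN≈e∘ι : ∀ a → eN ζ a ≈ e (ι a)
      eN≈e∘ι a = trans (reflexive (pow≡^ ζ (toℕ a))) (trans (ζ^≈e (toℕ a)) (reflexive (≡.cong e (≡.sym (ι≡+toℕ a)))))

      e≈1⇒≡0 : (∀ d → pow ζ d ≈ 1# → N ∣ d) → ∀ {a} → e a ≈ 1# → a ≡ + 0 mod N
      e≈1⇒≡0 ζ-primitive {a} eₐ≈1 with ζ-primitive (a %ℕ N)
        (trans (reflexive (pow≡^ ζ (a %ℕ N))) (trans (ζ^≈e (a %ℕ N)) (trans (e-cong (mod-sym (%ℕ-residue a))) eₐ≈1)))
      ... | divides q a%N≡qN = mod-trans (%ℕ-residue a)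
                                 (mod-trans (mod-reflexive (≡.trans (≡.cong +_ a%N≡qN) (ℤₚ.pos-* q N))) (multiple≡0-mod (+ q)))

      module _ (pk : ℕ) {{_ : NonZero pk}} (N≡pk*pk : N ≡ pk ℕ.* pk) where

        -- The vectors ζ_x

        record Localised (d a : ℤ) (X : Carrier) : Set ℓ where
          field
            on  : + pk ∣ℤ d → X ≈ e a
            off : ¬ (+ pk ∣ℤ d) → X ≈ 0#
        open Localised

        localised-unique : ∀ {d a X Y} → Localised d a X → Localised d a Y → X ≈ Y
        localised-unique {d} locX locY with + pk ∣ℤ? d
        ... | yes pk∣d = trans (on locX pk∣d) (sym (on locY pk∣d))
        ... | no  pk∤d = trans (off locX pk∤d) (sym (off locY pk∤d))

        localised-transport : ∀ {d a d′ a′ X} → Localised d a X →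
          (+ pk ∣ℤ d → + pk ∣ℤ d′) → (+ pk ∣ℤ d′ → + pk ∣ℤ d) → (+ pk ∣ℤ d → a ≡ a′ mod N) →
          Localised d′ a′ X
        localised-transport locX forth back a≡a′ = record
          { on  = λ pk∣d′ → trans (on locX (back pk∣d′)) (e-cong (a≡a′ (back pk∣d′)))
          ; off = λ pk∤d′ → off locX (λ pk∣d → pk∤d′ (forth pk∣d))
          }

        localised-scale : ∀ {d a X} b → Localised d a X → Localised d (b ℤ.+ a) (e b * X)
        localised-scale {a = a} {X} b locX = record
          { on  = λ pk∣d → trans (*-congˡ (on locX pk∣d)) (sym (e-+ b a))
          ; off = λ pk∤d → trans (*-congˡ (off locX pk∤d)) (zeroʳ (e b))
          }

        localised-cong : ∀ {d a X Y} → X ≈ Y → Localised d a X → Localised d a Y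
        localised-cong X≈Y locX = record
          { on  = λ pk∣d → trans (sym X≈Y) (on locX pk∣d)
          ; off = λ pk∤d → trans (sym X≈Y) (off locX pk∤d)
          }

        coset-point : ZN → Fin pk → ZN
        coset-point x₂ t = x₂ ⊕ (toZ pk ⊗ toZ (toℕ t))

        ι-coset-point : ∀ x₂ t → ι (coset-point x₂ t) ≡ ι x₂ ℤ.+ + pk ℤ.* + toℕ t mod N
        ι-coset-point x₂ t = mod-trans (ι-⊕ x₂ _) (+-congˡ-mod (ι x₂) (mod-trans (ι-⊗ _ _) (*-cong-mod (ι-toZ pk) (ι-toZ (toℕ t)))))

        coset-point-injective : ∀ x₂ {t t′} → coset-point x₂ t ≡ coset-point x₂ t′ → t ≡ t′
        coset-point-injective x₂ {t} {t′} eq = toℕ-injective (residues-unique (toℕ<n t) (toℕ<n t′)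
          (pk*-cancel-mod N≡pk*pk (+-cancelˡ-mod (ι x₂)
            (mod-trans (mod-sym (ι-coset-point x₂ t)) (mod-trans (mod-reflexive (≡.cong ι eq)) (ι-coset-point x₂ t′))))))

        coefficient : ZN → Fin pk → Carrier
        coefficient x₁ t = eN ζ (x₁ ⊗ (toZ (toℕ t) ⊗ toZ pk))

        zetaVec≡sum : ∀ x₁ x₂ z → zetaVec ζ pk (x₁ , x₂) z ≡ sum (λ t → coefficient x₁ t * δ (coset-point x₂ t) z)
        zetaVec≡sum x₁ x₂ z = sumFin≡sum pk _

        coefficient≈e : ∀ x₁ t → coefficient x₁ t ≈ e (ι x₁ ℤ.* (+ pk ℤ.* + toℕ t))
        coefficient≈e x₁ t = trans (eN≈e∘ι _) (e-cong (mod-trans (ι-⊗ x₁ _) (*-congˡ-mod (ι x₁)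
          (mod-trans (ι-⊗ _ _) (mod-trans (*-cong-mod (ι-toZ (toℕ t)) (ι-toZ pk)) (mod-reflexive (ℤₚ.*-comm (+ toℕ t) (+ pk))))))))

        coset-offset : ∀ x₂ t → ι (coset-point x₂ t) ℤ.- ι x₂ ≡ + pk ℤ.* + toℕ t mod N
        coset-offset x₂ t = mod-trans (+-congʳ-mod (ℤ.- ι x₂) (ι-coset-point x₂ t)) (mod-reflexive (cancel (ι x₂) _))
          where
          cancel : ∀ a b → a ℤ.+ b ℤ.- a ≡ b
          cancel = solve-∀

        zetaVec-on : ∀ x₁ x₂ z → + pk ∣ℤ ι z ℤ.- ι x₂ → zetaVec ζ pk (x₁ , x₂) z ≈ e (ι x₁ ℤ.* (ι z ℤ.- ι x₂))
        zetaVec-on x₁ x₂ z (divides u z-x₂≡u*pk) = begin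
          zetaVec ζ pk (x₁ , x₂) z            ≡⟨ zetaVec≡sum x₁ x₂ z ⟩
          sum (λ t → γ t * δ (p t) z)         ≈⟨ sum-select _ t₀ off-t₀ ⟩
          γ t₀ * δ (p t₀) z                   ≡⟨ ≡.cong (λ y → γ t₀ * δ (p t₀) y) z≡p₀ ⟩
          γ t₀ * δ (p t₀) (p t₀)              ≈⟨ trans (*-congˡ (δ-self (p t₀))) (*-identityʳ (γ t₀)) ⟩
          γ t₀                                ≈⟨ coefficient≈e x₁ t₀ ⟩
          e (ι x₁ ℤ.* (+ pk ℤ.* + toℕ t₀))    ≈⟨ e-cong (*-congˡ-mod (ι x₁) z-x₂≡pk*t₀) ⟨
          e (ι x₁ ℤ.* (ι z ℤ.- ι x₂))         ∎
          where
          open ≈-Reasoning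
          γ = coefficient x₁
          p = coset-point x₂
          t₀ : Fin pk
          t₀ = fromℕ< (n%ℕd<d u pk)
          u≡t₀ : u ≡ + toℕ t₀ mod pk
          u≡t₀ = ≡.subst (λ k → u ≡ + k mod pk) (≡.sym (toℕ-fromℕ< (n%ℕd<d u pk))) (%ℕ-residue u)
          z-x₂≡pk*t₀ : ι z ℤ.- ι x₂ ≡ + pk ℤ.* + toℕ t₀ mod N
          z-x₂≡pk*t₀ = mod-trans (mod-reflexive (≡.trans z-x₂≡u*pk (ℤₚ.*-comm u (+ pk)))) (pk*-cong-mod N≡pk*pk u≡t₀)
          z≡p₀ : z ≡ p t₀
          z≡p₀ = ι-injective (mod-trans (mod-reflexive (split (ι z) (ι x₂)))
            (mod-trans (+-congˡ-mod (ι x₂) z-x₂≡pk*t₀) (mod-sym (ι-coset-point x₂ t₀))))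
            where
            split : ∀ a b → a ≡ b ℤ.+ (a ℤ.- b)
            split = solve-∀
          off-t₀ : ∀ t → t ≢ t₀ → γ t * δ (p t) z ≈ 0#
          off-t₀ t t≢t₀ = trans (*-congˡ (δ-other (λ z≡pₜ → t≢t₀ (coset-point-injective x₂ (≡.trans (≡.sym z≡pₜ) z≡p₀))))) (zeroʳ (γ t))

        zetaVec-off : ∀ x₁ x₂ z → ¬ (+ pk ∣ℤ ι z ℤ.- ι x₂) → zetaVec ζ pk (x₁ , x₂) z ≈ 0#
        zetaVec-off x₁ x₂ z pk∤z-x₂ = trans (reflexive (zetaVec≡sum x₁ x₂ z)) (sum-zero _ λ t →
          trans (*-congˡ (δ-other (λ z≡pₜ → pk∤z-x₂ (on-coset t z≡pₜ)))) (zeroʳ _))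
          where
          on-coset : ∀ t → z ≡ coset-point x₂ t → + pk ∣ℤ ι z ℤ.- ι x₂
          on-coset t ≡.refl = ∣-resp-mod N≡pk*pk (mod-sym (coset-offset x₂ t)) (∣m⇒∣m*n (+ toℕ t) ℤ∣.∣-refl)

        zetaVec-localised : ∀ x₁ x₂ z → Localised (ι z ℤ.- ι x₂) (ι x₁ ℤ.* (ι z ℤ.- ι x₂)) (zetaVec ζ pk (x₁ , x₂) z)
        zetaVec-localised x₁ x₂ z = record { on = zetaVec-on x₁ x₂ z ; off = zetaVec-off x₁ x₂ z }

        module _ (r : ZN) (2r≡1 : twoZ ⊗ r ≡ oneZ) where

          2r-1≡0 : + 2 ℤ.* ι r ℤ.- + 1 ≡ + 0 mod N
          2r-1≡0 = mod⇒difference≡0 (mod-trans (*-congʳ-mod (ι r) (mod-sym (ι-toZ 2)))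
                     (mod-trans (mod-sym (ι-⊗ twoZ r)) (mod-trans (mod-reflexive (≡.cong ι 2r≡1)) (ι-toZ 1))))

          -- The twisted vector e(r x₁ x₂) ζ_x takes the value e (θ x₁ x₂ z) on its coset.
          θ : ℤ → ℤ → ℤ → ℤ
          θ x₁ x₂ z = ι r ℤ.* (x₁ ℤ.* x₂) ℤ.+ x₁ ℤ.* (z ℤ.- x₂)

          θ-cong : ∀ {x₁ x₁′ x₂ x₂′ z z′} → x₁ ≡ x₁′ mod N → x₂ ≡ x₂′ mod N → z ≡ z′ mod N →
                   θ x₁ x₂ z ≡ θ x₁′ x₂′ z′ mod N
          θ-cong x₁≡ x₂≡ z≡ = +-cong-mod (*-congˡ-mod (ι r) (*-cong-mod x₁≡ x₂≡)) (*-cong-mod x₁≡ (+-cong-mod z≡ (neg-cong-mod x₂≡)))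

          -- Action of the generators

          θ-nGen : ∀ b x₁ x₂ z → + pk ∣ℤ z ℤ.- x₂ →
                   ι r ℤ.* (b ℤ.* (z ℤ.* z)) ℤ.+ θ x₁ x₂ z ≡ θ (x₁ ℤ.+ b ℤ.* x₂) x₂ z mod N
          θ-nGen b x₁ x₂ z pk∣z-x₂ = mod-sym (begin
            θ (x₁ ℤ.+ b ℤ.* x₂) x₂ z                                 ≈⟨ +-*-zeroʳ-mod _ b correction≡0 ⟨
            θ (x₁ ℤ.+ b ℤ.* x₂) x₂ z ℤ.+ b ℤ.* correction            ≡⟨ expand (ι r) b x₁ x₂ z ⟩
            ι r ℤ.* (b ℤ.* (z ℤ.* z)) ℤ.+ θ x₁ x₂ z                  ∎)
            where
            open ≡-mod-Reasoning N
            d = z ℤ.- x₂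
            correction = ι r ℤ.* (d ℤ.* d) ℤ.+ x₂ ℤ.* d ℤ.* (+ 2 ℤ.* ι r ℤ.- + 1)
            correction≡0 : correction ≡ + 0 mod N
            correction≡0 = mod-trans (+-*-zeroʳ-mod _ (x₂ ℤ.* d) 2r-1≡0)
              (mod-trans (*-congˡ-mod (ι r) (∣⇒square≡0 N≡pk*pk pk∣z-x₂)) (mod-reflexive (ℤₚ.*-zeroʳ (ι r))))
            expand : ∀ r b x₁ x₂ z →
              r ℤ.* ((x₁ ℤ.+ b ℤ.* x₂) ℤ.* x₂) ℤ.+ (x₁ ℤ.+ b ℤ.* x₂) ℤ.* (z ℤ.- x₂)
                ℤ.+ b ℤ.* (r ℤ.* ((z ℤ.- x₂) ℤ.* (z ℤ.- x₂)) ℤ.+ x₂ ℤ.* (z ℤ.- x₂) ℤ.* (+ 2 ℤ.* r ℤ.- + 1))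
              ≡ r ℤ.* (b ℤ.* (z ℤ.* z)) ℤ.+ (r ℤ.* (x₁ ℤ.* x₂) ℤ.+ x₁ ℤ.* (z ℤ.- x₂))
            expand = solve-∀

          θ-aGen : ∀ t s x₁ x₂ z → t ℤ.* s ≡ + 1 mod N → θ x₁ x₂ (t ℤ.* z) ≡ θ (t ℤ.* x₁) (s ℤ.* x₂) z mod N
          θ-aGen t s x₁ x₂ z ts≡1 = begin
            θ x₁ x₂ (t ℤ.* z)                                                    ≈⟨ +-*-zeroʳ-mod _ ((ι r ℤ.- + 1) ℤ.* x₁ ℤ.* x₂) (mod⇒difference≡0 ts≡1) ⟨
            θ x₁ x₂ (t ℤ.* z) ℤ.+ (ι r ℤ.- + 1) ℤ.* x₁ ℤ.* x₂ ℤ.* (t ℤ.* s ℤ.- + 1) ≡⟨ expand (ι r) t s x₁ x₂ z ⟩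
            θ (t ℤ.* x₁) (s ℤ.* x₂) z                                            ∎
            where
            open ≡-mod-Reasoning N
            expand : ∀ r t s x₁ x₂ z →
              r ℤ.* (x₁ ℤ.* x₂) ℤ.+ x₁ ℤ.* (t ℤ.* z ℤ.- x₂) ℤ.+ (r ℤ.- + 1) ℤ.* x₁ ℤ.* x₂ ℤ.* (t ℤ.* s ℤ.- + 1)
              ≡ r ℤ.* (t ℤ.* x₁ ℤ.* (s ℤ.* x₂)) ℤ.+ t ℤ.* x₁ ℤ.* (z ℤ.- s ℤ.* x₂)
            expand = solve-∀

          θ-ωGen : ∀ x₁ x₂ z → ι r ℤ.* (x₁ ℤ.* x₂) ℤ.+ z ℤ.* x₂ ≡ θ x₂ (ℤ.- x₁) z mod N
          θ-ωGen x₁ x₂ z = begin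
            ι r ℤ.* (x₁ ℤ.* x₂) ℤ.+ z ℤ.* x₂                                          ≈⟨ +-*-zeroʳ-mod _ (ℤ.- (x₁ ℤ.* x₂)) 2r-1≡0 ⟨
            ι r ℤ.* (x₁ ℤ.* x₂) ℤ.+ z ℤ.* x₂ ℤ.+ ℤ.- (x₁ ℤ.* x₂) ℤ.* (+ 2 ℤ.* ι r ℤ.- + 1) ≡⟨ expand (ι r) x₁ x₂ z ⟩
            θ x₂ (ℤ.- x₁) z                                                           ∎
            where
            open ≡-mod-Reasoning N
            expand : ∀ r x₁ x₂ z →
              r ℤ.* (x₁ ℤ.* x₂) ℤ.+ z ℤ.* x₂ ℤ.+ ℤ.- (x₁ ℤ.* x₂) ℤ.* (+ 2 ℤ.* r ℤ.- + 1)
              ≡ r ℤ.* (x₂ ℤ.* ℤ.- x₁) ℤ.+ x₂ ℤ.* (z ℤ.- ℤ.- x₁)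
            expand = solve-∀

          twist : ZN × ZN → Carrier
          twist (x₁ , x₂) = e (ι r ℤ.* (ι x₁ ℤ.* ι x₂))

          twisted-zetaVec-localised : ∀ x₁ x₂ z →
            Localised (ι z ℤ.- ι x₂) (θ (ι x₁) (ι x₂) (ι z)) (twist (x₁ , x₂) * zetaVec ζ pk (x₁ , x₂) z)
          twisted-zetaVec-localised x₁ x₂ z = localised-scale _ (zetaVec-localised x₁ x₂ z)

          offset-cong : ∀ z {x₂ a} → ι x₂ ≡ a mod N → ι z ℤ.- a ≡ ι z ℤ.- ι x₂ mod N
          offset-cong z x₂≡a = +-congˡ-mod (ι z) (neg-cong-mod (mod-sym x₂≡a))

          module _ (invSqrtN : Carrier) where

            U : Gen → Fun → Fun
            U = Ugen ζ r invSqrtN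

            U-cong : ∀ g {φ ψ} → φ ≋ ψ → U g φ ≋ U g ψ
            U-cong (nGen b)     φ≋ψ z = *-congˡ (φ≋ψ z)
            U-cong (aGen t _ _) φ≋ψ z = φ≋ψ (t ⊗ z)
            U-cong ωGen         φ≋ψ z = *-congˡ (sumFin-cong (λ y → *-congʳ (φ≋ψ y)))

            U-scale : ∀ g a φ → U g (λ z → a * φ z) ≋ (λ z → a * U g φ z)
            U-scale (nGen b)     a φ z = x∙yz≈y∙xz _ a (φ z)
            U-scale (aGen _ _ _) a φ z = refl
            U-scale ωGen         a φ z = begin
              invSqrtN * sumFin N (λ y → a * φ y * k y)      ≡⟨ ≡.cong (invSqrtN *_) (sumFin≡sum N _) ⟩
              invSqrtN * sum {N} (λ y → a * φ y * k y)       ≈⟨ *-congˡ (sum-cong-≋ {N} (λ y → *-assoc a (φ y) (k y))) ⟩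
              invSqrtN * sum {N} (λ y → a * (φ y * k y))     ≈⟨ *-congˡ (*-distribˡ-sum {N} a (λ y → φ y * k y)) ⟨
              invSqrtN * (a * sum {N} (λ y → φ y * k y))     ≈⟨ x∙yz≈y∙xz invSqrtN a _ ⟩
              a * (invSqrtN * sum {N} (λ y → φ y * k y))     ≡⟨ ≡.cong (λ S → a * (invSqrtN * S)) (sumFin≡sum N _) ⟨
              a * (invSqrtN * sumFin N (λ y → φ y * k y))    ∎
              where
              open ≈-Reasoning
              k : ZN → Carrier
              k y = eN ζ ((twoZ ⊗ r) ⊗ (z ⊗ y))

            twisted-nGen : ∀ b x₁ x₂ z → let v′ = genMat (nGen b) ▷ (x₁ , x₂) in
              twist (x₁ , x₂) * U (nGen b) (zetaVec ζ pk (x₁ , x₂)) z ≈ twist v′ * zetaVec ζ pk v′ z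
            twisted-nGen b x₁ x₂ z = localised-unique
              (localised-transport (localised-cong regroup (localised-scale _ (twisted-zetaVec-localised x₁ x₂ z)))
                (∣-resp-mod N≡pk*pk offset) (∣-resp-mod N≡pk*pk (mod-sym offset))
                (λ pk∣z-x₂ → mod-trans (θ-nGen (ι b) (ι x₁) (ι x₂) (ι z) pk∣z-x₂) (θ-cong (mod-sym x₁′≡) (mod-sym x₂′≡) (mod-refl {a = ι z}))))
              (twisted-zetaVec-localised _ _ z)
              where
              x₁′≡ : ι ((oneZ ⊗ x₁) ⊕ (b ⊗ x₂)) ≡ ι x₁ ℤ.+ ι b ℤ.* ι x₂ mod N
              x₁′≡ = mod-trans (ι-⊕ _ _) (+-cong-mod (ι-1⊗ x₁) (ι-⊗ b x₂))
              x₂′≡ : ι ((zeroZ ⊗ x₁) ⊕ (oneZ ⊗ x₂)) ≡ ι x₂ mod N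
              x₂′≡ = mod-trans (ι-0⊗⊕ x₁ _) (ι-1⊗ x₂)
              offset : ι z ℤ.- ι x₂ ≡ ι z ℤ.- ι ((zeroZ ⊗ x₁) ⊕ (oneZ ⊗ x₂)) mod N
              offset = offset-cong z x₂′≡
              chirp : eN ζ (r ⊗ (b ⊗ (z ⊗ z))) ≈ e (ι r ℤ.* (ι b ℤ.* (ι z ℤ.* ι z)))
              chirp = trans (eN≈e∘ι _) (e-cong (mod-trans (ι-⊗ r _) (*-congˡ-mod (ι r) (mod-trans (ι-⊗ b _) (*-congˡ-mod (ι b) (ι-⊗ z z))))))
              regroup : e (ι r ℤ.* (ι b ℤ.* (ι z ℤ.* ι z))) * (twist (x₁ , x₂) * zetaVec ζ pk (x₁ , x₂) z)
                        ≈ twist (x₁ , x₂) * (eN ζ (r ⊗ (b ⊗ (z ⊗ z))) * zetaVec ζ pk (x₁ , x₂) z)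
              regroup = trans (x∙yz≈y∙xz _ _ _) (*-congˡ (*-congʳ (sym chirp)))

            twisted-aGen : ∀ t s (ts≡1 : t ⊗ s ≡ oneZ) x₁ x₂ z → let v′ = genMat (aGen t s ts≡1) ▷ (x₁ , x₂) in
              twist (x₁ , x₂) * U (aGen t s ts≡1) (zetaVec ζ pk (x₁ , x₂)) z ≈ twist v′ * zetaVec ζ pk v′ z
            twisted-aGen t s ts≡1 x₁ x₂ z = localised-unique
              (localised-transport (twisted-zetaVec-localised x₁ x₂ (t ⊗ z)) forth back
                (λ _ → mod-trans (θ-cong (mod-refl {a = ι x₁}) (mod-refl {a = ι x₂}) (ι-⊗ t z))
                  (mod-trans (θ-aGen (ι t) (ι s) (ι x₁) (ι x₂) (ι z) ts≡1-mod) (θ-cong (mod-sym x₁′≡) (mod-sym x₂′≡) (mod-refl {a = ι z})))))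
              (twisted-zetaVec-localised _ _ z)
              where
              open ≡-mod-Reasoning N
              ts≡1-mod : ι t ℤ.* ι s ≡ + 1 mod N
              ts≡1-mod = mod-trans (mod-sym (ι-⊗ t s)) (mod-trans (mod-reflexive (≡.cong ι ts≡1)) (ι-toZ 1))
              x₁′≡ : ι ((t ⊗ x₁) ⊕ (zeroZ ⊗ x₂)) ≡ ι t ℤ.* ι x₁ mod N
              x₁′≡ = mod-trans (ι-⊕0⊗ _ x₂) (ι-⊗ t x₁)
              x₂′≡ : ι ((zeroZ ⊗ x₁) ⊕ (s ⊗ x₂)) ≡ ι s ℤ.* ι x₂ mod N
              x₂′≡ = mod-trans (ι-0⊗⊕ x₁ _) (ι-⊗ s x₂)
              unit-twist : ∀ t s z x → t ℤ.* (z ℤ.- s ℤ.* x) ≡ (t ℤ.* z ℤ.- x) ℤ.+ ℤ.- x ℤ.* (t ℤ.* s ℤ.- + 1)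
              unit-twist = solve-∀
              unit-twist′ : ∀ t s z x → s ℤ.* (t ℤ.* z ℤ.- x) ≡ (z ℤ.- s ℤ.* x) ℤ.+ z ℤ.* (t ℤ.* s ℤ.- + 1)
              unit-twist′ = solve-∀
              forth : + pk ∣ℤ ι (t ⊗ z) ℤ.- ι x₂ → + pk ∣ℤ ι z ℤ.- ι ((zeroZ ⊗ x₁) ⊕ (s ⊗ x₂))
              forth pk∣d = ∣-resp-mod N≡pk*pk (begin
                ι s ℤ.* (ι (t ⊗ z) ℤ.- ι x₂)                              ≈⟨ *-congˡ-mod (ι s) (+-congʳ-mod (ℤ.- ι x₂) (ι-⊗ t z)) ⟩
                ι s ℤ.* (ι t ℤ.* ι z ℤ.- ι x₂)                            ≡⟨ unit-twist′ (ι t) (ι s) (ι z) (ι x₂) ⟩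
                (ι z ℤ.- ι s ℤ.* ι x₂) ℤ.+ ι z ℤ.* (ι t ℤ.* ι s ℤ.- + 1)   ≈⟨ +-*-zeroʳ-mod (ι z ℤ.- ι s ℤ.* ι x₂) (ι z) (mod⇒difference≡0 ts≡1-mod) ⟩
                ι z ℤ.- ι s ℤ.* ι x₂                                      ≈⟨ offset-cong z x₂′≡ ⟩
                ι z ℤ.- ι ((zeroZ ⊗ x₁) ⊕ (s ⊗ x₂))                       ∎) (∣n⇒∣m*n (ι s) pk∣d)
              back : + pk ∣ℤ ι z ℤ.- ι ((zeroZ ⊗ x₁) ⊕ (s ⊗ x₂)) → + pk ∣ℤ ι (t ⊗ z) ℤ.- ι x₂
              back pk∣d′ = ∣-resp-mod N≡pk*pk (begin
                ι t ℤ.* (ι z ℤ.- ι ((zeroZ ⊗ x₁) ⊕ (s ⊗ x₂)))              ≈⟨ *-congˡ-mod (ι t) (offset-cong z x₂′≡) ⟨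
                ι t ℤ.* (ι z ℤ.- ι s ℤ.* ι x₂)                            ≡⟨ unit-twist (ι t) (ι s) (ι z) (ι x₂) ⟩
                (ι t ℤ.* ι z ℤ.- ι x₂) ℤ.+ ℤ.- ι x₂ ℤ.* (ι t ℤ.* ι s ℤ.- + 1) ≈⟨ +-*-zeroʳ-mod (ι t ℤ.* ι z ℤ.- ι x₂) (ℤ.- ι x₂) (mod⇒difference≡0 ts≡1-mod) ⟩
                ι t ℤ.* ι z ℤ.- ι x₂                                      ≈⟨ +-congʳ-mod (ℤ.- ι x₂) (ι-⊗ t z) ⟨
                ι (t ⊗ z) ℤ.- ι x₂                                        ∎) (∣n⇒∣m*n (ι t) pk∣d′)

            module _ (invSqrtN*pk≈1 : invSqrtN * fromℕ pk ≈ 1#)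
                     (ζ-primitive : ∀ d → pow ζ d ≈ 1# → N ∣ d)
                     (no-zero-divisors : ∀ a b → a * b ≈ 0# → a ≈ 0# ⊎ b ≈ 0#) where

              ωGen-sum : ∀ x₁ x₂ z →
                sumFin N (λ y → zetaVec ζ pk (x₁ , x₂) y * eN ζ ((twoZ ⊗ r) ⊗ (z ⊗ y)))
                  ≈ e (ι z ℤ.* ι x₂) * geometric-sum (e ((ι x₁ ℤ.+ ι z) ℤ.* + pk)) pk
              ωGen-sum x₁ x₂ z = begin
                sumFin N (λ y → zetaVec ζ pk (x₁ , x₂) y * eN ζ ((twoZ ⊗ r) ⊗ (z ⊗ y)))
                  ≡⟨ sumFin≡sum N _ ⟩
                sum {N} (λ y → zetaVec ζ pk (x₁ , x₂) y * eN ζ ((twoZ ⊗ r) ⊗ (z ⊗ y)))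
                  ≈⟨ sum-cong-≋ {N} (λ y → *-cong (reflexive (zetaVec≡sum x₁ x₂ y)) (kernel y)) ⟩
                sum {N} (λ y → sum {pk} (λ t → coefficient x₁ t * δ (coset-point x₂ t) y) * e (ι z ℤ.* ι y))
                  ≈⟨ sum-against-δ (coefficient x₁) (coset-point x₂) (λ y → e (ι z ℤ.* ι y)) ⟩
                sum {pk} (λ t → coefficient x₁ t * e (ι z ℤ.* ι (coset-point x₂ t)))
                  ≈⟨ sum-cong-≋ {pk} term ⟩
                sum {pk} (λ t → e (ι z ℤ.* ι x₂) * w ^ toℕ t)
                  ≈⟨ *-distribˡ-sum {pk} (e (ι z ℤ.* ι x₂)) (λ t → w ^ toℕ t) ⟨
                e (ι z ℤ.* ι x₂) * geometric-sum w pk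
                  ∎
                where
                open ≈-Reasoning
                w = e ((ι x₁ ℤ.+ ι z) ℤ.* + pk)
                kernel : ∀ y → eN ζ ((twoZ ⊗ r) ⊗ (z ⊗ y)) ≈ e (ι z ℤ.* ι y)
                kernel y = trans (eN≈e∘ι _) (e-cong (mod-trans (ι-⊗ _ _)
                  (mod-trans (*-cong-mod (mod-trans (mod-reflexive (≡.cong ι 2r≡1)) (ι-toZ 1)) (ι-⊗ z y)) (mod-reflexive (ℤₚ.*-identityˡ _)))))
                collect : ∀ x₁ x₂ z p t → x₁ ℤ.* (p ℤ.* t) ℤ.+ z ℤ.* (x₂ ℤ.+ p ℤ.* t) ≡ z ℤ.* x₂ ℤ.+ (x₁ ℤ.+ z) ℤ.* p ℤ.* t
                collect = solve-∀
                term : ∀ t → coefficient x₁ t * e (ι z ℤ.* ι (coset-point x₂ t)) ≈ e (ι z ℤ.* ι x₂) * w ^ toℕ t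
                term t = begin
                  coefficient x₁ t * e (ι z ℤ.* ι (coset-point x₂ t))
                    ≈⟨ *-cong (coefficient≈e x₁ t) (e-cong (*-congˡ-mod (ι z) (ι-coset-point x₂ t))) ⟩
                  e (ι x₁ ℤ.* (+ pk ℤ.* + toℕ t)) * e (ι z ℤ.* (ι x₂ ℤ.+ + pk ℤ.* + toℕ t))
                    ≈⟨ e-+ _ _ ⟨
                  e (ι x₁ ℤ.* (+ pk ℤ.* + toℕ t) ℤ.+ ι z ℤ.* (ι x₂ ℤ.+ + pk ℤ.* + toℕ t))
                    ≡⟨ ≡.cong e (collect (ι x₁) (ι x₂) (ι z) (+ pk) (+ toℕ t)) ⟩
                  e (ι z ℤ.* ι x₂ ℤ.+ (ι x₁ ℤ.+ ι z) ℤ.* + pk ℤ.* + toℕ t)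
                    ≈⟨ e-+ _ _ ⟩
                  e (ι z ℤ.* ι x₂) * e ((ι x₁ ℤ.+ ι z) ℤ.* + pk ℤ.* + toℕ t)
                    ≈⟨ *-congˡ (e-^ _ (toℕ t)) ⟩
                  e (ι z ℤ.* ι x₂) * w ^ toℕ t
                    ∎

              ωGen-localised : ∀ x₁ x₂ z →
                Localised (ι x₁ ℤ.+ ι z) (ι r ℤ.* (ι x₁ ℤ.* ι x₂) ℤ.+ ι z ℤ.* ι x₂)
                          (twist (x₁ , x₂) * U ωGen (zetaVec ζ pk (x₁ , x₂)) z)
              ωGen-localised x₁ x₂ z = record { on = on-coset ; off = off-coset }
                where
                open ≈-Reasoning
                w = e ((ι x₁ ℤ.+ ι z) ℤ.* + pk)
                E = e (ι z ℤ.* ι x₂)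
                LHS = twist (x₁ , x₂) * U ωGen (zetaVec ζ pk (x₁ , x₂)) z
                LHS≈ : LHS ≈ twist (x₁ , x₂) * (invSqrtN * (E * geometric-sum w pk))
                LHS≈ = *-congˡ (*-congˡ (ωGen-sum x₁ x₂ z))
                on-coset : + pk ∣ℤ ι x₁ ℤ.+ ι z → LHS ≈ e (ι r ℤ.* (ι x₁ ℤ.* ι x₂) ℤ.+ ι z ℤ.* ι x₂)
                on-coset pk∣x₁+z = begin
                  LHS                                                   ≈⟨ LHS≈ ⟩
                  twist (x₁ , x₂) * (invSqrtN * (E * geometric-sum w pk)) ≈⟨ *-congˡ (*-congˡ (*-congˡ G≈pk)) ⟩
                  twist (x₁ , x₂) * (invSqrtN * (E * fromℕ pk))          ≈⟨ *-congˡ (x∙yz≈y∙xz invSqrtN E (fromℕ pk)) ⟩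
                  twist (x₁ , x₂) * (E * (invSqrtN * fromℕ pk))          ≈⟨ *-congˡ (*-congˡ invSqrtN*pk≈1) ⟩
                  twist (x₁ , x₂) * (E * 1#)                              ≈⟨ *-congˡ (*-identityʳ E) ⟩
                  twist (x₁ , x₂) * E                                     ≈⟨ e-+ _ _ ⟨
                  e (ι r ℤ.* (ι x₁ ℤ.* ι x₂) ℤ.+ ι z ℤ.* ι x₂)           ∎
                  where
                  w≈1 : w ≈ 1#
                  w≈1 = trans (e-cong (∣⇒*pk≡0 N≡pk*pk pk∣x₁+z)) e-0
                  G≈pk : geometric-sum w pk ≈ fromℕ pk
                  G≈pk = trans (sum-cong-≋ {pk} (λ t → trans (^-congˡ (toℕ t) w≈1) (1#^n≈1# (toℕ t))))
                               (reflexive (≡.sym (fromℕ≡sum-of-1# pk)))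
                off-coset : ¬ (+ pk ∣ℤ ι x₁ ℤ.+ ι z) → LHS ≈ 0#
                off-coset pk∤x₁+z with geometric-sum-dichotomy no-zero-divisors {w} {pk} w^pk≈1
                  where
                  w^pk≈1 : w ^ pk ≈ 1#
                  w^pk≈1 = trans (sym (e-^ _ pk)) (trans (e-cong (∣⇒*pk≡0 N≡pk*pk (∣n⇒∣m*n (ι x₁ ℤ.+ ι z) ℤ∣.∣-refl))) e-0)
                ... | inj₁ w≈1 = contradiction (*pk≡0⇒∣ N≡pk*pk (e≈1⇒≡0 ζ-primitive w≈1)) pk∤x₁+z
                ... | inj₂ G≈0 = trans LHS≈ (trans (*-congˡ (*-congˡ (trans (*-congˡ G≈0) (zeroʳ E)))) (trans (*-congˡ (zeroʳ invSqrtN)) (zeroʳ _)))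

              twisted-ωGen : ∀ x₁ x₂ z → let v′ = genMat ωGen ▷ (x₁ , x₂) in
                twist (x₁ , x₂) * U ωGen (zetaVec ζ pk (x₁ , x₂)) z ≈ twist v′ * zetaVec ζ pk v′ z
              twisted-ωGen x₁ x₂ z = localised-unique
                (localised-transport (ωGen-localised x₁ x₂ z)
                  (∣-resp-mod N≡pk*pk offset) (∣-resp-mod N≡pk*pk (mod-sym offset))
                  (λ _ → mod-trans (θ-ωGen (ι x₁) (ι x₂) (ι z)) (θ-cong (mod-sym x₁′≡) (mod-sym x₂′≡) (mod-refl {a = ι z}))))
                (twisted-zetaVec-localised _ _ z)
                where
                x₁′≡ : ι ((zeroZ ⊗ x₁) ⊕ (oneZ ⊗ x₂)) ≡ ι x₂ mod N
                x₁′≡ = mod-trans (ι-0⊗⊕ x₁ _) (ι-1⊗ x₂)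
                x₂′≡ : ι (((⊖ oneZ) ⊗ x₁) ⊕ (zeroZ ⊗ x₂)) ≡ ℤ.- ι x₁ mod N
                x₂′≡ = mod-trans (ι-⊕0⊗ _ x₂) (mod-trans (ι-⊗ _ x₁)
                         (mod-trans (*-congʳ-mod (ι x₁) (mod-trans (ι-⊖ oneZ) (neg-cong-mod (ι-toZ 1)))) (mod-reflexive (ℤₚ.-1*i≡-i (ι x₁)))))
                swap : ∀ x z → x ℤ.+ z ≡ z ℤ.- ℤ.- x
                swap = solve-∀
                offset : ι x₁ ℤ.+ ι z ≡ ι z ℤ.- ι (((⊖ oneZ) ⊗ x₁) ⊕ (zeroZ ⊗ x₂)) mod N
                offset = mod-trans (mod-reflexive (swap (ι x₁) (ι z))) (offset-cong z x₂′≡)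

              twisted-Ugen : ∀ g v z → twist v * U g (zetaVec ζ pk v) z ≈ twist (genMat g ▷ v) * zetaVec ζ pk (genMat g ▷ v) z
              twisted-Ugen (nGen b)         (x₁ , x₂) = twisted-nGen b x₁ x₂
              twisted-Ugen (aGen t s ts≡1) (x₁ , x₂) = twisted-aGen t s ts≡1 x₁ x₂
              twisted-Ugen ωGen             (x₁ , x₂) = twisted-ωGen x₁ x₂

              twisted-Uword : ∀ w v z →
                twist v * Uword ζ r invSqrtN w (zetaVec ζ pk v) z ≈ twist (wordMat w ▷ v) * zetaVec ζ pk (wordMat w ▷ v) z
              twisted-Uword []      v z = reflexive (≡.cong (λ u → twist u * zetaVec ζ pk u z) (≡.sym (idM-▷ v)))
              twisted-Uword (g ∷ w) v z = begin
                twist v * U g (Uword ζ r invSqrtN w (zetaVec ζ pk v)) z    ≈⟨ U-scale g (twist v) _ z ⟨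
                U g (λ y → twist v * Uword ζ r invSqrtN w (zetaVec ζ pk v) y) z ≈⟨ U-cong g (twisted-Uword w v) z ⟩
                U g (λ y → twist v′ * zetaVec ζ pk v′ y) z                  ≈⟨ U-scale g (twist v′) _ z ⟩
                twist v′ * U g (zetaVec ζ pk v′) z                          ≈⟨ twisted-Ugen g v′ z ⟩
                twist (genMat g ▷ v′) * zetaVec ζ pk (genMat g ▷ v′) z      ≡⟨ ≡.cong (λ u → twist u * zetaVec ζ pk u z) (▷-·M (genMat g) (wordMat w) v) ⟨
                twist (wordMat (g ∷ w) ▷ v) * zetaVec ζ pk (wordMat (g ∷ w) ▷ v) z ∎
                where
                open ≈-Reasoning
                v′ = wordMat w ▷ v

              Uword-zetaVec : ∀ w x₁ x₂ →
                let x′ = wordMat w ▷ (x₁ , x₂)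
                    x₁′ = proj₁ x′
                    x₂′ = proj₂ x′
                in Uword ζ r invSqrtN w (zetaVec ζ pk (x₁ , x₂))
                   ≋ (λ z → eN ζ (r ⊗ ((x₁′ ⊗ x₂′) ⊝ (x₁ ⊗ x₂))) * zetaVec ζ pk x′ z)
              Uword-zetaVec w x₁ x₂ z = begin
                V                                         ≈⟨ *-identityˡ V ⟨
                1# * V                                    ≈⟨ *-congʳ (e-neg q) ⟨
                e (ℤ.- q) * e q * V                       ≈⟨ *-assoc _ _ _ ⟩
                e (ℤ.- q) * (twist (x₁ , x₂) * V)         ≈⟨ *-congˡ (twisted-Uword w (x₁ , x₂) z) ⟩
                e (ℤ.- q) * (e q′ * zetaVec ζ pk x′ z)    ≈⟨ *-assoc _ _ _ ⟨
                e (ℤ.- q) * e q′ * zetaVec ζ pk x′ z      ≈⟨ *-congʳ (e-+ (ℤ.- q) q′) ⟨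
                e (ℤ.- q ℤ.+ q′) * zetaVec ζ pk x′ z      ≈⟨ *-congʳ phase ⟨
                eN ζ (r ⊗ ((x₁′ ⊗ x₂′) ⊝ (x₁ ⊗ x₂))) * zetaVec ζ pk x′ z ∎
                where
                open ≈-Reasoning
                x′ = wordMat w ▷ (x₁ , x₂)
                x₁′ = proj₁ x′
                x₂′ = proj₂ x′
                V = Uword ζ r invSqrtN w (zetaVec ζ pk (x₁ , x₂)) z
                q = ι r ℤ.* (ι x₁ ℤ.* ι x₂)
                q′ = ι r ℤ.* (ι x₁′ ℤ.* ι x₂′)
                distribute : ∀ r a b → r ℤ.* (a ℤ.+ ℤ.- b) ≡ ℤ.- (r ℤ.* b) ℤ.+ r ℤ.* a
                distribute = solve-∀
                phase : eN ζ (r ⊗ ((x₁′ ⊗ x₂′) ⊝ (x₁ ⊗ x₂))) ≈ e (ℤ.- q ℤ.+ q′)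
                phase = trans (eN≈e∘ι _) (e-cong (mod-trans (ι-⊗ r _)
                  (mod-trans (*-congˡ-mod (ι r) (mod-trans (ι-⊕ _ _) (+-cong-mod (ι-⊗ x₁′ x₂′) (mod-trans (ι-⊖ _) (neg-cong-mod (ι-⊗ x₁ x₂))))))
                    (mod-reflexive (distribute (ι r) (ι x₁′ ℤ.* ι x₂′) (ι x₁ ℤ.* ι x₂))))))

mainTheorem7 : {c ℓ : Level} (R : CommutativeRing c ℓ)
    (p k : ℕ) → Prime p → p ℕ.> 3 → k ℕ.≥ 1 → {{nz : NonZero (p ℕ.^ (2 ℕ.* k))}} →
    let open CommutativeRing R
        open Weil R (p ℕ.^ (2 ℕ.* k))
    in (ζ : Carrier) → pow ζ (p ℕ.^ (2 ℕ.* k)) ≈ 1# →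
       (∀ d → pow ζ d ≈ 1# → p ℕ.^ (2 ℕ.* k) ∣ d) →
       (∀ a b → a * b ≈ 0# → a ≈ 0# ⊎ b ≈ 0#) →
       (invSqrtN : Carrier) → invSqrtN * fromℕ (p ℕ.^ k) ≈ 1# →
       (r : ZN) → twoZ ⊗ r ≡ oneZ →
       (w : List Gen) → det (wordMat w) ≡ oneZ →
       (x₁ x₂ : ZN) →
       let B = wordMat w
           x′ = B ▷ (x₁ , x₂)
           x₁′ = Data.Product.proj₁ x′
           x₂′ = Data.Product.proj₂ x′
       in Uword ζ r invSqrtN w (zetaVec ζ (p ℕ.^ k) (x₁ , x₂))
          ≋ (λ z → eN ζ (r ⊗ ((x₁′ ⊗ x₂′) ⊝ (x₁ ⊗ x₂))) * zetaVec ζ (p ℕ.^ k) x′ z)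
mainTheorem7 R p k _ p>3 _ ζ ζᴺ≈1 ζ-primitive no-zero-divisors invSqrtN invSqrtN*pk≈1 r 2r≡1 w _ x₁ x₂ =
  Uword-zetaVec R (p ℕ.^ (2 ℕ.* k)) ζ ζᴺ≈1 (p ℕ.^ k) N≡pk*pk r 2r≡1 invSqrtN invSqrtN*pk≈1 ζ-primitive no-zero-divisors w x₁ x₂
  where
  instance
    pk≢0 : NonZero (p ℕ.^ k)
    pk≢0 = ℕₚ.m^n≢0 p k {{ℕ.>-nonZero (ℕₚ.<-trans (ℕ.s≤s ℕ.z≤n) p>3)}}
  N≡pk*pk : p ℕ.^ (2 ℕ.* k) ≡ p ℕ.^ k ℕ.* p ℕ.^ k
  N≡pk*pk = ≡.trans (≡.cong (λ m → p ℕ.^ (k ℕ.+ m)) (ℕₚ.+-identityʳ k)) (ℕₚ.^-distribˡ-+-* p k k)
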